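{- Let $N=2^n$ and let $G\subseteq[N]\times[N]$ be a uniformly random bipartite graph. Then asymptotically almost surely (as $n\to\infty$), $D_\cap(G\mid\mathcal G_{N,N})=\Theta(N)$; i.e., there are absolute constants $0<c_1\le c_2$ with $\Pr[c_1N\le D_\cap(G\mid\mathcal G_{N,N})\le c_2N]\to1$.
   Context: $\mathcal G_{N,N}=\{R_1,\dots,R_N,C_1,\dots,C_N\}$ on $\Gamma=[N]\times[N]$, with $R_i=\{(i,j):j\in[N]\}$ and $C_j=\{(i,j):i\in[N]\}$. A sequence $A_1,\dots,A_t$ ($t\ge1$) of subsets of $\Gamma$ generates $A$ from $\mathcal B$ if $A_t=A$ and each $A_i$ equals $X\cup Y$ or $X\cap Y$ for some (not necessarily distinct) $X,Y\in\mathcal B\cup\{A_1,\dots,A_{i-1}\}$. $D_\cap(A\mid\mathcal B)$ is the minimum number of intersection steps over all sequences generating $A$ from $\mathcal B$ ($\infty$ if none). -}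

module Defs where

open import Data.Nat using (ℕ; zero; suc; _+_; _*_; _∸_; _^_; _≤_)
open import Data.Bool using (Bool; true; false; _∨_; _∧_; if_then_else_)
open import Data.Fin using (Fin)
open import Data.Fin.Properties using (_≟_)
open import Data.Vec using (Vec; tabulate; zipWith; replicate)
open import Data.List using (List; []; _∷_; _++_; map; length)
open import Data.List.Membership.Propositional using (_∈_)
open import Data.List.Relation.Unary.All using (All)
open import Data.List.Relation.Unary.Unique.Propositional using (Unique)
open import Data.Product using (Σ; _×_; _,_)
open import Relation.Nullary.Decidable using (⌊_⌋)
open import Data.List using (allFin)

-- A subset of Γ = [N] × [N], as an N×N Boolean matrix:
-- entry (i , j) is true iff (i , j) ∈ A.
GridSet : ℕ → Set
GridSet N = Vec (Vec Bool N) N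

_∪G_ : ∀ {N} → GridSet N → GridSet N → GridSet N
A ∪G B = zipWith (zipWith _∨_) A B

_∩G_ : ∀ {N} → GridSet N → GridSet N → GridSet N
A ∩G B = zipWith (zipWith _∧_) A B

Row : ∀ {N} → Fin N → GridSet N
Row {N} i = tabulate λ i' → tabulate λ j → ⌊ i' ≟ i ⌋

Col : ∀ {N} → Fin N → GridSet N
Col {N} j = tabulate λ i → tabulate λ j' → ⌊ j' ≟ j ⌋

gridFamily : (N : ℕ) → List (GridSet N)
gridFamily N = map Row (allFin N) ++ map Col (allFin N)

-- Steps B prev k : 'prev' is the list of sets produced so far
-- (most recent first, i.e. A_{i-1} ∷ … ∷ A_1), and k is the number
-- of intersection steps used.
data Steps {N : ℕ} (B : List (GridSet N)) : List (GridSet N) → ℕ → Set where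
  start : Steps B [] 0
  ∪step : ∀ {prev k X Y} → Steps B prev k → X ∈ B ++ prev → Y ∈ B ++ prev →
          Steps B ((X ∪G Y) ∷ prev) k
  ∩step : ∀ {prev k X Y} → Steps B prev k → X ∈ B ++ prev → Y ∈ B ++ prev →
          Steps B ((X ∩G Y) ∷ prev) (suc k)

GeneratesWith : ∀ {N} → List (GridSet N) → GridSet N → ℕ → Set
GeneratesWith B A k = Σ (List _) λ prev → Steps B (A ∷ prev) k

-- "N ≤ q · D_∩(A | B)"  (i.e. D_∩ ≥ N/q), unfolded via the minimum:
-- every generating sequence uses at least N/q intersection steps
-- (vacuous if D_∩ = ∞, consistent with ∞ ≥ N/q).
D∩-lower : ∀ {N} → (q : ℕ) → List (GridSet N) → GridSet N → Set
D∩-lower {N} q B A = ∀ k → GeneratesWith B A k → N ≤ q * k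

D∩-upper : ∀ {N} → (c : ℕ) → List (GridSet N) → GridSet N → Set
D∩-upper {N} c B A = Σ ℕ λ k → GeneratesWith B A k × k ≤ c * N

Good : (q c N : ℕ) → GridSet N → Set
Good q c N G = D∩-lower q (gridFamily N) G × D∩-upper c (gridFamily N) G

-- Upper bound: for a row i and any other row i′, G ∩ R_i = R_i ∩ (R_{i′} ∪ ⋃_{(i,j) ∈ G} C_j), so G is
-- the union of N such slices and is generated with N + 1 intersections (one extra slice seeds the union).
--
-- Lower bound: in a sequence with k intersections every set is a union of "wires" (the k intersection
-- results and the 2N generators), and each intersection is taken between two such unions.  The sequence is
-- therefore captured by a circuit of k gates, each given by two masks on at most k + 2N wires, plus a mask
-- selecting the output.  For k ≤ N/16 this allows at most 2^((k+1)·2(k+2N)) ≈ 2^(N²/4) sets, a vanishing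
-- fraction of the 2^(N²) graphs; every other graph needs more than N/16 intersections.

module Submission where

open import Defs
open import Algebra.Bundles using (CommutativeSemigroup)
open import Data.Bool using (Bool; true; false; _∨_; _∧_; if_then_else_; T)
import Data.Bool as Bool
open import Data.Bool.ListAction using (any; or)
open import Data.Bool.Properties using (∨-assoc; ∨-identityʳ; ∧-comm; ∧-identityʳ; ∧-zeroʳ; ∨-abs-∧; T-∧; T-≡; ⇔→≡)
open import Data.Empty using (⊥-elim)
open import Data.Fin using (Fin; zero; suc)
open import Data.Fin.Properties using (_≟_)
import Data.Fin.Subset.Properties as Subset
open import Data.List using (List; []; _∷_; [_]; _++_; length; foldr; map; filter; allFin; cartesianProductWith; cartesianProduct)
open import Data.List.Properties using (map-cong; length-++; length-++-sucʳ; length-map; length-tabulate)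
open import Data.List.Membership.Propositional using (_∈_; _∉_; lose)
open import Data.List.Membership.Propositional.Properties
  using (∈-allFin; ∈-++⁺ˡ; ∈-++⁺ʳ; ∈-++⁻; ∈-∃++; ∈-map⁺; ∈-filter⁺; ∈-cartesianProductWith⁺; ∈-cartesianProduct⁺)
import Data.List.Membership.DecPropositional as DecMembership
open import Data.List.Relation.Binary.Subset.Propositional using (_⊆_)
open import Data.List.Relation.Binary.Subset.Propositional.Properties using (xs⊆xs++ys; xs⊆ys++xs; ++⁺ʳ)
open import Data.List.Relation.Unary.All as All using (All; []; _∷_)
open import Data.List.Relation.Unary.All.Properties using (++⁺; all-filter)
open import Data.List.Relation.Unary.AllPairs using ([]; _∷_)
open import Data.List.Relation.Unary.Any using (here; there; satisfied)
open import Data.List.Relation.Unary.Any.Properties using (any⁺; any⁻)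
open import Data.List.Relation.Unary.Unique.Propositional using (Unique)
import Data.List.Relation.Unary.Unique.Propositional.Properties as Unique
open import Data.Nat using (ℕ; zero; suc; _+_; _*_; _∸_; _^_; _≤_; _<_; _≤′_; ≤′-reflexive; ≤′-step; z≤n; s≤s; _≤?_)
open import Data.Nat.Properties hiding (_≟_)
open import Data.Nat.Tactic.RingSolver using (solve-∀)
open import Data.Product using (Σ; _×_; _,_; proj₁; proj₂; uncurry)
open import Data.Sum using (inj₁; inj₂)
open import Data.Vec using (Vec; []; _∷_; lookup; replicate; zipWith; fromList)
open import Data.Vec.Properties
  using (lookup-zipWith; lookup∘tabulate; tabulate∘lookup; tabulate-cong; zipWith-assoc; zipWith-comm; zipWith-idem; zipWith-identityʳ; ≡-dec)
open import Function using (id; _∘_; mk⇔; Equivalence)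
open import Level using (0ℓ)
open import Relation.Binary.Definitions using (DecidableEquality)
open import Relation.Binary.PropositionalEquality using (_≡_; refl; sym; trans; cong; cong₂; subst; subst₂; module ≡-Reasoning)
open import Relation.Binary.PropositionalEquality.Algebra using (isMagma)
open import Relation.Nullary using (yes; no; ¬?)
open import Relation.Nullary.Decidable using (⌊_⌋; toWitness; fromWitness)

∅G : ∀ {N} → GridSet N
∅G {N} = replicate N (replicate N false)

-- Rows are elements of Subset N and ∪G is the rowwise Subset union, so its laws lift from Subset.
module _ {N : ℕ} where

  ∪G-assoc : (A B C : GridSet N) → (A ∪G B) ∪G C ≡ A ∪G (B ∪G C)
  ∪G-assoc = zipWith-assoc Subset.∪-assoc

  ∪G-comm : (A B : GridSet N) → A ∪G B ≡ B ∪G A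
  ∪G-comm = zipWith-comm Subset.∪-comm

  ∪G-idem : (A : GridSet N) → A ∪G A ≡ A
  ∪G-idem = zipWith-idem Subset.∪-idem

  ∪G-identityʳ : (A : GridSet N) → A ∪G ∅G ≡ A
  ∪G-identityʳ = zipWith-identityʳ Subset.∪-identityʳ

∪G-commutativeSemigroup : ℕ → CommutativeSemigroup 0ℓ 0ℓ
∪G-commutativeSemigroup N = record
  { _∙_ = _∪G_ {N}
  ; isCommutativeSemigroup = record
    { isSemigroup = record { isMagma = isMagma _∪G_ ; assoc = ∪G-assoc }
    ; comm = ∪G-comm
    }
  }

at : ∀ {N} → GridSet N → Fin N → Fin N → Bool
at A x y = lookup (lookup A x) y

module _ {N : ℕ} where

  grid-ext : {A B : GridSet N} → (∀ x y → at A x y ≡ at B x y) → A ≡ B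
  grid-ext h = vec-ext λ x → vec-ext (h x)
    where
    vec-ext : ∀ {C : Set} {n} {u v : Vec C n} → (∀ i → lookup u i ≡ lookup v i) → u ≡ v
    vec-ext {u = u} {v} h = trans (sym (tabulate∘lookup u)) (trans (tabulate-cong h) (tabulate∘lookup v))

  at-∪G : (A B : GridSet N) (x y : Fin N) → at (A ∪G B) x y ≡ at A x y ∨ at B x y
  at-∪G A B x y = trans (cong (λ r → lookup r y) (lookup-zipWith _ x A B)) (lookup-zipWith _ y (lookup A x) (lookup B x))

  at-∩G : (A B : GridSet N) (x y : Fin N) → at (A ∩G B) x y ≡ at A x y ∧ at B x y
  at-∩G A B x y = trans (cong (λ r → lookup r y) (lookup-zipWith _ x A B)) (lookup-zipWith _ y (lookup A x) (lookup B x))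

  at-Row : (i x y : Fin N) → at (Row i) x y ≡ ⌊ x ≟ i ⌋
  at-Row i x y = trans (cong (λ r → lookup r y) (lookup∘tabulate _ x)) (lookup∘tabulate _ y)

  at-Col : (j x y : Fin N) → at (Col j) x y ≡ ⌊ y ≟ j ⌋
  at-Col j x y = trans (cong (λ r → lookup r y) (lookup∘tabulate _ x)) (lookup∘tabulate _ y)

any-δ : ∀ {n} (g : Fin n → Bool) (y : Fin n) → any (λ j → ⌊ y ≟ j ⌋ ∧ g j) (allFin n) ≡ g y
any-δ {n} g y = ⇔→≡ {z = true} (mk⇔ (to ∘ T⁻) (T⁺ ∘ from ∘ T⁻))
  where
  T⁻ : ∀ {b} → b ≡ true → T b
  T⁻ = Equivalence.from T-≡
  T⁺ : ∀ {b} → T b → b ≡ true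
  T⁺ = Equivalence.to T-≡
  to : T (any (λ j → ⌊ y ≟ j ⌋ ∧ g j) (allFin n)) → g y ≡ true
  to t = let _ , δgj = satisfied (any⁻ _ (allFin n) t)
             δ , gj = Equivalence.to T-∧ δgj
         in T⁺ (subst (T ∘ g) (sym (toWitness δ)) gj)
  from : T (g y) → T (any (λ j → ⌊ y ≟ j ⌋ ∧ g j) (allFin n))
  from gy = any⁺ _ (lose (∈-allFin y) (Equivalence.from T-∧ (fromWitness refl , gy)))

any-cong : ∀ {A : Set} {p q : A → Bool} → (∀ x → p x ≡ q x) → ∀ xs → any p xs ≡ any q xs
any-cong p≗q xs = cong or (map-cong p≗q xs)

unionOver : ∀ {N} {A : Set} → (A → GridSet N) → GridSet N → List A → GridSet N
unionOver F base = foldr (λ j → F j ∪G_) base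

at-unionOver : ∀ {N} {A : Set} (F : A → GridSet N) base js (x y : Fin N) →
               at (unionOver F base js) x y ≡ any (λ j → at (F j) x y) js ∨ at base x y
at-unionOver F base []       x y = refl
at-unionOver F base (j ∷ js) x y = begin
  at (F j ∪G unionOver F base js) x y                  ≡⟨ at-∪G (F j) _ x y ⟩
  at (F j) x y ∨ at (unionOver F base js) x y          ≡⟨ cong (at (F j) x y ∨_) (at-unionOver F base js x y) ⟩
  at (F j) x y ∨ (any (λ j → at (F j) x y) js ∨ at base x y) ≡⟨ ∨-assoc (at (F j) x y) _ _ ⟨
  any (λ j → at (F j) x y) (j ∷ js) ∨ at base x y      ∎
  where open ≡-Reasoning

module Generation {N : ℕ} (B : List (GridSet N)) where

  Constructible : ℕ → GridSet N → Set
  Constructible k X = Σ (List (GridSet N)) λ prev → Steps B prev k × X ∈ B ++ prev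

  steps-++ : ∀ {ys xs k l} → Steps B ys k → Steps B xs l → Steps B (ys ++ xs) (k + l)
  steps-++ start t = t
  steps-++ {xs = xs} (∪step {prev} s x∈ y∈) t =
    ∪step (steps-++ s t) (++⁺ʳ B (xs⊆xs++ys prev xs) x∈) (++⁺ʳ B (xs⊆xs++ys prev xs) y∈)
  steps-++ {xs = xs} (∩step {prev} s x∈ y∈) t =
    ∩step (steps-++ s t) (++⁺ʳ B (xs⊆xs++ys prev xs) x∈) (++⁺ʳ B (xs⊆xs++ys prev xs) y∈)

  constructible-base : ∀ {X} → X ∈ B → Constructible 0 X
  constructible-base X∈B = [] , start , ∈-++⁺ˡ X∈B

  private
    combine : ∀ {k l X Y} → Constructible k X → Constructible l Y →
              Σ (List (GridSet N)) λ prev → Steps B prev (k + l) × X ∈ B ++ prev × Y ∈ B ++ prev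
    combine (ys , s , X∈) (xs , t , Y∈) =
      ys ++ xs , steps-++ s t , ++⁺ʳ B (xs⊆xs++ys ys xs) X∈ , ++⁺ʳ B (xs⊆ys++xs xs ys) Y∈

  constructible-∪ : ∀ {k l X Y} → Constructible k X → Constructible l Y → Constructible (k + l) (X ∪G Y)
  constructible-∪ cX cY with prev , s , X∈ , Y∈ ← combine cX cY = _ , ∪step s X∈ Y∈ , ∈-++⁺ʳ B (here refl)

  constructible-∩ : ∀ {k l X Y} → Constructible k X → Constructible l Y → Constructible (suc (k + l)) (X ∩G Y)
  constructible-∩ cX cY with prev , s , X∈ , Y∈ ← combine cX cY = _ , ∩step s X∈ Y∈ , ∈-++⁺ʳ B (here refl)

  constructible⇒generates : ∀ {k X} → Constructible k X → GeneratesWith B X k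
  constructible⇒generates {k} {X} (prev , s , X∈) =
    prev , subst (λ Y → Steps B (Y ∷ prev) k) (∪G-idem X) (∪step s X∈ X∈)

  constructible-unionOver : ∀ {A : Set} {F : A → GridSet N} {base c k} →
    (∀ j → Constructible c (F j)) → Constructible k base →
    ∀ js → Constructible (length js * c + k) (unionOver F base js)
  constructible-unionOver cF cbase [] = cbase
  constructible-unionOver {F = F} {base} {c} {k} cF cbase (j ∷ js) =
    subst (λ n → Constructible n (unionOver F base (j ∷ js))) (sym (+-assoc c (length js * c) k))
      (constructible-∪ (cF j) (constructible-unionOver cF cbase js))

Row∈gridFamily : ∀ {N} (i : Fin N) → Row i ∈ gridFamily N
Row∈gridFamily i = ∈-++⁺ˡ (∈-map⁺ Row (∈-allFin i))

Col∈gridFamily : ∀ {N} (j : Fin N) → Col j ∈ gridFamily N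
Col∈gridFamily {N} j = ∈-++⁺ʳ (map Row (allFin N)) (∈-map⁺ Col (∈-allFin j))

length-gridFamily : ∀ N → length (gridFamily N) ≡ N + N
length-gridFamily N = trans (length-++ (map Row (allFin N)))
  (cong₂ _+_ (trans (length-map Row (allFin N)) (length-tabulate {n = N} id))
             (trans (length-map Col (allFin N)) (length-tabulate {n = N} id)))

module _ {n : ℕ} (G : GridSet (suc (suc n))) where

  private
    N : ℕ
    N = suc (suc n)

  open Generation (gridFamily N)

  other : Fin N → Fin N
  other zero    = suc zero
  other (suc _) = zero

  ⌊i≟other-i⌋ : ∀ i → ⌊ i ≟ other i ⌋ ≡ false
  ⌊i≟other-i⌋ zero    = refl
  ⌊i≟other-i⌋ (suc _) = refl

  -- Row (other i) is empty on row i; it stands in for the empty set, which is not a generator.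
  column : Fin N → Fin N → GridSet N
  column i j = if at G i j then Col j else Row (other i)

  columnsOf : Fin N → GridSet N
  columnsOf i = unionOver (column i) (Row (other i)) (allFin N)

  slice : Fin N → GridSet N
  slice i = Row i ∩G columnsOf i

  at-column : ∀ i j y → at (column i j) i y ≡ ⌊ y ≟ j ⌋ ∧ at G i j
  at-column i j y with at G i j
  ... | true  = trans (at-Col j i y) (sym (∧-identityʳ _))
  ... | false = trans (at-Row (other i) i y) (trans (⌊i≟other-i⌋ i) (sym (∧-zeroʳ _)))

  at-columnsOf : ∀ i y → at (columnsOf i) i y ≡ at G i y
  at-columnsOf i y = begin
    at (columnsOf i) i y                                           ≡⟨ at-unionOver (column i) (Row (other i)) (allFin N) i y ⟩
    any (λ j → at (column i j) i y) (allFin N) ∨ at (Row (other i)) i y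
      ≡⟨ cong₂ _∨_ (any-cong (λ j → at-column i j y) (allFin N)) (trans (at-Row (other i) i y) (⌊i≟other-i⌋ i)) ⟩
    any (λ j → ⌊ y ≟ j ⌋ ∧ at G i j) (allFin N) ∨ false             ≡⟨ ∨-identityʳ _ ⟩
    any (λ j → ⌊ y ≟ j ⌋ ∧ at G i j) (allFin N)                     ≡⟨ any-δ (at G i) y ⟩
    at G i y                                                        ∎
    where open ≡-Reasoning

  at-slice : ∀ i x y → at (slice i) x y ≡ ⌊ x ≟ i ⌋ ∧ at G x y
  at-slice i x y = trans (at-∩G (Row i) (columnsOf i) x y) (trans (cong (_∧ at (columnsOf i) x y) (at-Row i x y)) (onRow x))
    where
    onRow : ∀ x → ⌊ x ≟ i ⌋ ∧ at (columnsOf i) x y ≡ ⌊ x ≟ i ⌋ ∧ at G x y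
    onRow x with x ≟ i
    ... | yes refl = at-columnsOf x y
    ... | no _     = refl

  union-of-slices : unionOver slice (slice zero) (allFin N) ≡ G
  union-of-slices = grid-ext λ x y → begin
    at (unionOver slice (slice zero) (allFin N)) x y                ≡⟨ at-unionOver slice (slice zero) (allFin N) x y ⟩
    any (λ i → at (slice i) x y) (allFin N) ∨ at (slice zero) x y
      ≡⟨ cong₂ _∨_ (any-cong (λ i → at-slice i x y) (allFin N)) (at-slice zero x y) ⟩
    any (λ i → ⌊ x ≟ i ⌋ ∧ at G x y) (allFin N) ∨ (⌊ x ≟ zero ⌋ ∧ at G x y)
      ≡⟨ cong₂ _∨_ (any-δ (λ _ → at G x y) x) (∧-comm _ (at G x y)) ⟩
    at G x y ∨ (at G x y ∧ ⌊ x ≟ zero ⌋)                            ≡⟨ ∨-abs-∧ (at G x y) _ ⟩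
    at G x y                                                        ∎
    where open ≡-Reasoning

  constructible-column : ∀ i j → Constructible 0 (column i j)
  constructible-column i j with at G i j
  ... | true  = constructible-base (Col∈gridFamily j)
  ... | false = constructible-base (Row∈gridFamily (other i))

  constructible-columnsOf : ∀ i → Constructible 0 (columnsOf i)
  constructible-columnsOf i =
    subst (λ c → Constructible c (columnsOf i)) (trans (+-identityʳ _) (*-zeroʳ (length (allFin N))))
      (constructible-unionOver (constructible-column i) (constructible-base (Row∈gridFamily (other i))) (allFin N))

  constructible-slice : ∀ i → Constructible 1 (slice i)
  constructible-slice i = constructible-∩ (constructible-base (Row∈gridFamily i)) (constructible-columnsOf i)

  generates-in-N+1 : GeneratesWith (gridFamily N) G (length (allFin N) * 1 + 1)
  generates-in-N+1 = subst (λ X → GeneratesWith (gridFamily N) X (length (allFin N) * 1 + 1)) union-of-slices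
    (constructible⇒generates (constructible-unionOver constructible-slice (constructible-slice zero) (allFin N)))

D∩-upper-2 : ∀ {N} → 2 ≤ N → (G : GridSet N) → D∩-upper 2 (gridFamily N) G
D∩-upper-2 {N@(suc (suc _))} (s≤s (s≤s z≤n)) G = length (allFin N) * 1 + 1 , generates-in-N+1 G , bound
  where
  open ≤-Reasoning
  bound : length (allFin N) * 1 + 1 ≤ 2 * N
  bound = begin
    length (allFin N) * 1 + 1 ≡⟨ cong (_+ 1) (trans (*-identityʳ _) (length-tabulate {n = N} id)) ⟩
    N + 1                     ≤⟨ +-monoʳ-≤ N (s≤s z≤n) ⟩
    N + N                     ≡⟨ cong (N +_) (+-identityʳ N) ⟨
    2 * N                     ∎

length-cartesianProductWith : ∀ {A B C : Set} (f : A → B → C) xs ys →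
                              length (cartesianProductWith f xs ys) ≡ length xs * length ys
length-cartesianProductWith f []       ys = refl
length-cartesianProductWith f (x ∷ xs) ys = trans (length-++ (map (f x) ys))
  (cong₂ _+_ (length-map (f x) ys) (length-cartesianProductWith f xs ys))

vectors : ∀ {A : Set} → List A → (n : ℕ) → List (Vec A n)
vectors xs zero    = [ [] ]
vectors xs (suc n) = cartesianProductWith _∷_ xs (vectors xs n)

module _ {A : Set} {xs : List A} where

  ∈-vectors : (∀ x → x ∈ xs) → ∀ {n} (v : Vec A n) → v ∈ vectors xs n
  ∈-vectors all []      = here refl
  ∈-vectors all (x ∷ v) = ∈-cartesianProductWith⁺ _∷_ (all x) (∈-vectors all v)

  vectors-unique : Unique xs → ∀ n → Unique (vectors xs n)
  vectors-unique u zero    = [] ∷ []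
  vectors-unique u (suc n) =
    Unique.cartesianProductWith⁺ _∷_ (λ { refl → refl , refl }) u (vectors-unique u n)

  length-vectors : ∀ n → length (vectors xs n) ≡ length xs ^ n
  length-vectors zero    = refl
  length-vectors (suc n) =
    trans (length-cartesianProductWith _∷_ xs (vectors xs n)) (cong (length xs *_) (length-vectors n))

bits : (n : ℕ) → List (Vec Bool n)
bits = vectors (true ∷ false ∷ [])

∈-bits : ∀ {n} (v : Vec Bool n) → v ∈ bits n
∈-bits = ∈-vectors λ { true → here refl ; false → there (here refl) }

grids : (N : ℕ) → List (GridSet N)
grids N = vectors (bits N) N

grids-unique : ∀ N → Unique (grids N)
grids-unique N = vectors-unique (vectors-unique (((λ ()) ∷ []) ∷ [] ∷ []) N) N

length-grids : ∀ N → length (grids N) ≡ 2 ^ (N * N)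
length-grids N = trans (length-vectors N) (trans (cong (_^ N) (length-vectors N)) (^-*-assoc 2 N N))

select : ∀ {N n} → Vec Bool n → Vec (GridSet N) n → GridSet N
select []          []       = ∅G
select (true  ∷ m) (X ∷ xs) = X ∪G select m xs
select (false ∷ m) (X ∷ xs) = select m xs

module _ {N : ℕ} where

  open import Algebra.Properties.CommutativeSemigroup (∪G-commutativeSemigroup N) using (interchange; x∙yz≈y∙xz)

  select-none : ∀ {n} (xs : Vec (GridSet N) n) → select (replicate n false) xs ≡ ∅G
  select-none []       = refl
  select-none (X ∷ xs) = select-none xs

  select-head : ∀ {n} X (xs : Vec (GridSet N) n) → select (true ∷ replicate n false) (X ∷ xs) ≡ X
  select-head X xs = trans (cong (X ∪G_) (select-none xs)) (∪G-identityʳ X)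

  select-∨ : ∀ {n} (m m′ : Vec Bool n) xs → select (zipWith _∨_ m m′) xs ≡ select m xs ∪G select m′ xs
  select-∨ []          []           []       = sym (∪G-idem ∅G)
  select-∨ (true  ∷ m) (true  ∷ m′) (X ∷ xs) = begin
    X ∪G select (zipWith _∨_ m m′) xs                ≡⟨ cong (X ∪G_) (select-∨ m m′ xs) ⟩
    X ∪G (select m xs ∪G select m′ xs)               ≡⟨ cong (_∪G _) (∪G-idem X) ⟨
    (X ∪G X) ∪G (select m xs ∪G select m′ xs)        ≡⟨ interchange X X _ _ ⟩
    (X ∪G select m xs) ∪G (X ∪G select m′ xs)        ∎
    where open ≡-Reasoning
  select-∨ (true  ∷ m) (false ∷ m′) (X ∷ xs) = trans (cong (X ∪G_) (select-∨ m m′ xs)) (sym (∪G-assoc X _ _))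
  select-∨ (false ∷ m) (true  ∷ m′) (X ∷ xs) = trans (cong (X ∪G_) (select-∨ m m′ xs)) (x∙yz≈y∙xz X _ _)
  select-∨ (false ∷ m) (false ∷ m′) (X ∷ xs) = select-∨ m m′ xs

  select-fromList : ∀ {X xs} → X ∈ xs → Σ (Vec Bool (length xs)) λ m → select m (fromList xs) ≡ X
  select-fromList {xs = X ∷ xs} (here refl) = true ∷ replicate _ false , select-head X (fromList xs)
  select-fromList (there X∈xs) = let m , eq = select-fromList X∈xs in false ∷ m , eq

m≤2^[k*e]⇒m*2^e≤2^[1+k]*e : ∀ k e {m} → m ≤ 2 ^ (k * e) → m * 2 ^ e ≤ 2 ^ (suc k * e)
m≤2^[k*e]⇒m*2^e≤2^[1+k]*e k e {m} m≤ = begin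
  m * 2 ^ e           ≤⟨ *-monoˡ-≤ (2 ^ e) m≤ ⟩
  2 ^ (k * e) * 2 ^ e ≡⟨ ^-distribˡ-+-* 2 (k * e) e ⟨
  2 ^ (k * e + e)     ≡⟨ cong (2 ^_) (+-comm (k * e) e) ⟩
  2 ^ (suc k * e)     ∎
  where open ≤-Reasoning

module Circuits {N : ℕ} (B : List (GridSet N)) where

  width : ℕ → ℕ
  width k = k + length B

  data Circuit : ℕ → Set where
    inputs : Circuit 0
    gate   : ∀ {k} → Circuit k → (S T : Vec Bool (width k)) → Circuit (suc k)

  wires : ∀ {k} → Circuit k → Vec (GridSet N) (width k)
  wires inputs       = fromList B
  wires (gate c S T) = (select S (wires c) ∩G select T (wires c)) ∷ wires c

  Spans : ∀ {k} → Circuit k → GridSet N → Set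
  Spans {k} c X = Σ (Vec Bool (width k)) λ m → select m (wires c) ≡ X

  spans-∪ : ∀ {k} (c : Circuit k) {X Y} → Spans c X → Spans c Y → Spans c (X ∪G Y)
  spans-∪ c (m , refl) (m′ , refl) = zipWith _∨_ m m′ , select-∨ m m′ (wires c)

  spans-gate : ∀ {k} (c : Circuit k) S T {X} → Spans c X → Spans (gate c S T) X
  spans-gate c S T (m , eq) = false ∷ m , eq

  spans-output : ∀ {k} (c : Circuit k) S T → Spans (gate c S T) (select S (wires c) ∩G select T (wires c))
  spans-output c S T = true ∷ replicate _ false , select-head _ (wires c)

  circuit-of : ∀ {prev k} → Steps B prev k → Σ (Circuit k) λ c → All (Spans c) B × All (Spans c) prev
  circuit-of start = inputs , All.tabulate select-fromList , []
  circuit-of (∪step s X∈ Y∈) with c , spB , spPrev ← circuit-of s =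
    c , spB , spans-∪ c (All.lookup (++⁺ spB spPrev) X∈) (All.lookup (++⁺ spB spPrev) Y∈) ∷ spPrev
  circuit-of (∩step s X∈ Y∈) with c , spB , spPrev ← circuit-of s =
    let S , S≡X = All.lookup (++⁺ spB spPrev) X∈
        T , T≡Y = All.lookup (++⁺ spB spPrev) Y∈
    in gate c S T , All.map (spans-gate c S T) spB ,
       subst₂ (λ X Y → Spans (gate c S T) (X ∩G Y)) S≡X T≡Y (spans-output c S T) ∷ All.map (spans-gate c S T) spPrev

  -- Idle gates let a circuit with k ≤ K gates be counted among those with exactly K gates.
  pad : ∀ {k K} → k ≤′ K → Circuit k → Circuit K
  pad (≤′-reflexive refl) c = c
  pad (≤′-step k≤′K)      c = gate (pad k≤′K c) (replicate _ false) (replicate _ false)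

  spans-pad : ∀ {k K X} {c : Circuit k} (k≤′K : k ≤′ K) → Spans c X → Spans (pad k≤′K c) X
  spans-pad (≤′-reflexive refl) sp = sp
  spans-pad {c = c} (≤′-step k≤′K) sp = spans-gate (pad k≤′K c) (replicate _ false) (replicate _ false) (spans-pad k≤′K sp)

  generates⇒spans : ∀ {A k K} → GeneratesWith B A k → k ≤ K → Σ (Circuit K) λ c → Spans c A
  generates⇒spans (_ , s) k≤K with c , _ , spA ∷ _ ← circuit-of s = pad (≤⇒≤′ k≤K) c , spans-pad (≤⇒≤′ k≤K) spA

  circuits : (k : ℕ) → List (Circuit k)
  circuits zero    = [ inputs ]
  circuits (suc k) = cartesianProductWith (λ c → uncurry (gate c)) (circuits k) (cartesianProduct (bits (width k)) (bits (width k)))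

  ∈-circuits : ∀ {k} (c : Circuit k) → c ∈ circuits k
  ∈-circuits inputs       = here refl
  ∈-circuits (gate c S T) = ∈-cartesianProductWith⁺ _ (∈-circuits c) (∈-cartesianProduct⁺ (∈-bits S) (∈-bits T))

  length-circuits : ∀ k → length (circuits k) ≤ 2 ^ (k * (width k + width k))
  length-circuits zero    = ≤-refl
  length-circuits (suc k) = begin
    length (circuits (suc k))
      ≡⟨ length-cartesianProductWith _ (circuits k) (cartesianProduct (bits (width k)) (bits (width k))) ⟩
    length (circuits k) * length (cartesianProduct (bits (width k)) (bits (width k)))
      ≡⟨ cong (length (circuits k) *_) length-pairs ⟩
    length (circuits k) * 2 ^ (width k + width k)
      ≤⟨ m≤2^[k*e]⇒m*2^e≤2^[1+k]*e k (width k + width k) (length-circuits k) ⟩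
    2 ^ (suc k * (width k + width k))
      ≤⟨ ^-monoʳ-≤ 2 (*-monoʳ-≤ (suc k) (+-mono-≤ (n≤1+n (width k)) (n≤1+n (width k)))) ⟩
    2 ^ (suc k * (width (suc k) + width (suc k))) ∎
    where
    open ≤-Reasoning
    length-pairs : length (cartesianProduct (bits (width k)) (bits (width k))) ≡ 2 ^ (width k + width k)
    length-pairs = trans (length-cartesianProductWith _,_ (bits (width k)) (bits (width k)))
      (trans (cong₂ _*_ (length-vectors (width k)) (length-vectors (width k))) (sym (^-distribˡ-+-* 2 (width k) (width k))))

  spannedSets : ℕ → List (GridSet N)
  spannedSets K = cartesianProductWith (λ c m → select m (wires c)) (circuits K) (bits (width K))

  ∈-spannedSets : ∀ {K X} (c : Circuit K) → Spans c X → X ∈ spannedSets K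
  ∈-spannedSets c (m , refl) = ∈-cartesianProductWith⁺ _ (∈-circuits c) (∈-bits m)

  length-spannedSets : ∀ K → length (spannedSets K) ≤ 2 ^ (suc K * (width K + width K))
  length-spannedSets K = begin
    length (spannedSets K)                        ≡⟨ length-cartesianProductWith _ (circuits K) (bits (width K)) ⟩
    length (circuits K) * length (bits (width K)) ≡⟨ cong (length (circuits K) *_) (length-vectors (width K)) ⟩
    length (circuits K) * 2 ^ width K             ≤⟨ *-monoʳ-≤ (length (circuits K)) (^-monoʳ-≤ 2 (m≤n+m (width K) (width K))) ⟩
    length (circuits K) * 2 ^ (width K + width K) ≤⟨ m≤2^[k*e]⇒m*2^e≤2^[1+k]*e K (width K + width K) (length-circuits K) ⟩
    2 ^ (suc K * (width K + width K))             ∎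
    where open ≤-Reasoning

  ∉spannedSets⇒D∩-lower : ∀ {q K A} → N ≤ q * K → A ∉ spannedSets K → D∩-lower q B A
  ∉spannedSets⇒D∩-lower {q} {K} N≤qK A∉ k gen with N ≤? q * k
  ... | yes N≤qk = N≤qk
  ... | no  N≰qk = ⊥-elim (A∉ (∈-spannedSets c spans))
    where
    k≤K : k ≤ K
    k≤K = <⇒≤ (*-cancelˡ-< q k K (<-≤-trans (≰⇒> N≰qk) N≤qK))
    c = proj₁ (generates⇒spans gen k≤K)
    spans = proj₂ (generates⇒spans gen k≤K)

unique-⊆⇒length≤ : ∀ {A : Set} {xs ys : List A} → Unique xs → xs ⊆ ys → length xs ≤ length ys
unique-⊆⇒length≤ {xs = []}     _            _     = z≤n
unique-⊆⇒length≤ {xs = x ∷ xs} (x∉xs ∷ uxs) xs⊆ys with ys₁ , ys₂ , refl ← ∈-∃++ (xs⊆ys (here refl)) =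
  begin
    suc (length xs)            ≤⟨ s≤s (unique-⊆⇒length≤ uxs drop-x) ⟩
    suc (length (ys₁ ++ ys₂))  ≡⟨ length-++-sucʳ ys₁ x ys₂ ⟨
    length (ys₁ ++ x ∷ ys₂)    ∎
  where
  open ≤-Reasoning
  drop-x : xs ⊆ ys₁ ++ ys₂
  drop-x {z} z∈xs with ∈-++⁻ ys₁ (xs⊆ys (there z∈xs))
  ... | inj₁ z∈ys₁         = ∈-++⁺ˡ z∈ys₁
  ... | inj₂ (there z∈ys₂) = ∈-++⁺ʳ ys₁ z∈ys₂
  ... | inj₂ (here z≡x)    = ⊥-elim (All.lookup x∉xs z∈xs (sym z≡x))

module _ {A : Set} (_≟_ : DecidableEquality A) where

  open DecMembership _≟_ using (_∈?_)

  length≤length-filter-∉+length : ∀ bad {xs} → Unique xs →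
    length xs ≤ length (filter (λ x → ¬? (x ∈? bad)) xs) + length bad
  length≤length-filter-∉+length bad {xs} uxs =
    ≤-trans (unique-⊆⇒length≤ uxs xs⊆good++bad) (≤-reflexive (length-++ (filter (λ x → ¬? (x ∈? bad)) xs)))
    where
    xs⊆good++bad : xs ⊆ filter (λ x → ¬? (x ∈? bad)) xs ++ bad
    xs⊆good++bad {x} x∈xs with x ∈? bad
    ... | yes x∈bad = ∈-++⁺ʳ _ x∈bad
    ... | no  x∉bad = ∈-++⁺ˡ (∈-filter⁺ (λ x → ¬? (x ∈? bad)) x∈xs x∉bad)

_≟G_ : ∀ {N} → DecidableEquality (GridSet N)
_≟G_ = ≡-dec (≡-dec Bool._≟_)

n<2^n : ∀ n → n < 2 ^ n
n<2^n zero    = s≤s z≤n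
n<2^n (suc n) = begin-strict
  suc n         ≤⟨ n<2^n n ⟩
  2 ^ n         <⟨ m<m+n (2 ^ n) (m^n>0 2 n) ⟩
  2 ^ n + 2 ^ n ≡⟨ cong (2 ^ n +_) (+-identityʳ (2 ^ n)) ⟨
  2 ^ suc n     ∎
  where open ≤-Reasoning

-- The exponent of 2^a · |spannedSets a| over the 2N generators, for N = 16a.
exponent-bound : ∀ a → 1 ≤ a → a + suc a * ((a + (16 * a + 16 * a)) + (a + (16 * a + 16 * a))) ≤ 16 * a * (16 * a)
exponent-bound a@(suc _) _ = begin
  a + suc a * ((a + (16 * a + 16 * a)) + (a + (16 * a + 16 * a))) ≡⟨ expand a ⟩
  66 * (a * a) + 67 * a       ≤⟨ +-monoʳ-≤ (66 * (a * a)) (*-monoʳ-≤ 67 (m≤m*n a a)) ⟩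
  66 * (a * a) + 67 * (a * a) ≤⟨ +-monoʳ-≤ (66 * (a * a)) (m≤m+n (67 * (a * a)) (123 * (a * a))) ⟩
  66 * (a * a) + (67 * (a * a) + 123 * (a * a)) ≡⟨ collect a ⟩
  16 * a * (16 * a)           ∎
  where
  open ≤-Reasoning
  expand : ∀ a → a + suc a * ((a + (16 * a + 16 * a)) + (a + (16 * a + 16 * a))) ≡ 66 * (a * a) + 67 * a
  expand = solve-∀
  collect : ∀ a → 66 * (a * a) + (67 * (a * a) + 123 * (a * a)) ≡ 16 * a * (16 * a)
  collect = solve-∀

density-bound : ∀ j T ℓ M → T ≤ ℓ + M → suc j * M ≤ T → j * T ≤ suc j * ℓ
density-bound j T ℓ M T≤ℓ+M [1+j]M≤T = +-cancelˡ-≤ T (j * T) (suc j * ℓ) (begin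
  T + j * T               ≤⟨ *-monoʳ-≤ (suc j) T≤ℓ+M ⟩
  suc j * (ℓ + M)         ≡⟨ *-distribˡ-+ (suc j) ℓ M ⟩
  suc j * ℓ + suc j * M   ≤⟨ +-monoʳ-≤ (suc j * ℓ) [1+j]M≤T ⟩
  suc j * ℓ + T           ≡⟨ +-comm (suc j * ℓ) T ⟩
  T + suc j * ℓ           ∎)
  where open ≤-Reasoning

GoodFraction : ℕ → ℕ → ℕ → ℕ → Set
GoodFraction q c k N =
  Σ (List (GridSet N)) λ L → Unique L × All (Good q c N) L × (k ∸ 1) * 2 ^ (N * N) ≤ k * length L

good-graphs-dense : ∀ a j → 1 ≤ a → suc j ≤ 2 ^ a → GoodFraction 16 2 (suc j) (16 * a)
good-graphs-dense a j 1≤a [1+j]≤2^a =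
  L , Unique.filter⁺ ∉bad? (grids-unique N) , All.map good (all-filter ∉bad? (grids N)) ,
  density-bound j (2 ^ (N * N)) (length L) (length bad) covered few-bad
  where
  N = 16 * a
  open Circuits (gridFamily N)
  open DecMembership (_≟G_ {N}) using (_∈?_)
  bad = spannedSets a
  ∉bad? = λ G → ¬? (G ∈? bad)
  L = filter ∉bad? (grids N)

  good : ∀ {G} → G ∉ bad → Good 16 2 N G
  good G∉bad = ∉spannedSets⇒D∩-lower {16} {a} ≤-refl G∉bad , D∩-upper-2 (≤-trans (s≤s (s≤s z≤n)) (*-monoʳ-≤ 16 1≤a)) _

  covered : 2 ^ (N * N) ≤ length L + length bad
  covered = subst (_≤ length L + length bad) (length-grids N)
    (length≤length-filter-∉+length _≟G_ bad (grids-unique N))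

  few-bad : suc j * length bad ≤ 2 ^ (N * N)
  few-bad = begin
    suc j * length bad                             ≤⟨ *-mono-≤ [1+j]≤2^a (length-spannedSets a) ⟩
    2 ^ a * 2 ^ (suc a * (width a + width a))      ≡⟨ ^-distribˡ-+-* 2 a _ ⟨
    2 ^ (a + suc a * (width a + width a))          ≤⟨ ^-monoʳ-≤ 2 exponent≤ ⟩
    2 ^ (N * N)                                    ∎
    where
    open ≤-Reasoning
    exponent≤ : a + suc a * (width a + width a) ≤ N * N
    exponent≤ = subst (λ b → a + suc a * ((a + b) + (a + b)) ≤ N * N) (sym (length-gridFamily N)) (exponent-bound a 1≤a)

eventually-dense : ∀ j → Σ ℕ λ n₀ → ∀ n → n₀ ≤ n → GoodFraction 16 2 (suc j) (2 ^ n)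
eventually-dense j = 4 + suc j , dense
  where
  dense : ∀ n → 4 + suc j ≤ n → GoodFraction 16 2 (suc j) (2 ^ n)
  dense n n₀≤n with d , refl ← m≤n⇒∃[o]m+o≡n n₀≤n =
    subst (GoodFraction 16 2 (suc j)) (sym (^-distribˡ-+-* 2 4 m)) (good-graphs-dense (2 ^ m) j (m^n>0 2 m) [1+j]≤2^2^m)
    where
    m = suc j + d
    [1+j]≤2^2^m : suc j ≤ 2 ^ 2 ^ m
    [1+j]≤2^2^m = ≤-trans (m≤m+n (suc j) d) (<⇒≤ (<-trans (n<2^n m) (n<2^n (2 ^ m))))

proposition4p1 : Σ ℕ λ q → Σ ℕ λ c → 1 ≤ q × 1 ≤ c ×
    (∀ k → 1 ≤ k → Σ ℕ λ n₀ → ∀ n → n₀ ≤ n →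
    Σ (List (GridSet (2 ^ n))) λ L →
    Unique L × All (Good q c (2 ^ n)) L ×
    (k ∸ 1) * 2 ^ ((2 ^ n) * (2 ^ n)) ≤ k * length L)
proposition4p1 = 16 , 2 , s≤s z≤n , s≤s z≤n , λ { (suc j) _ → eventually-dense j }
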